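{- Let $G$ be a finite abelian group, $X\subset G$ with $0\in X$, and $k$ a positive integer. Suppose $H+P$ is a symmetric $2$-proper coset-progression of the form $H+\{\sum_{i=1}^d x_ia_i: x_i\in\mathbb{Z},\ |x_i|\le N_i\}$ (with $H$ a subgroup of $G$, $a_i\in G$) that contains $kX$. Then $$X\subset H+\Big\{\sum_{i=1}^d x_ia_i: x_i\in\mathbb{Z},\ |x_i|\le 2N_i/k\Big\}.$$
   Context: $kX=\{x_1+\dots+x_k:x_i\in X\}$. For $P=\{\sum_{i=1}^d x_ia_i:|x_i|\le N_i\}$ and integer $t\ge1$, $P_t=\{\sum_{i=1}^d x_ia_i:|x_i|\le tN_i\}$. The coset-progression $H+P$ is $2$-proper if $P_2$ is proper (every element of $P_2$ has a unique representation $\sum x_ia_i$ with $|x_i|\le 2N_i$) and $|H+P_2|=|H||P_2|$. -}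

module Defs where

open import Level using (Level; _⊔_)
open import Algebra.Bundles using (AbelianGroup)
open import Data.Nat using (ℕ; zero; suc; _*_; _≤_)
open import Data.Integer using (ℤ; +_; -[1+_]; ∣_∣)
open import Data.Fin using (Fin)
open import Data.Product using (Σ; ∃; _×_; _,_)
open import Data.Unit.Polymorphic using (⊤)
open import Relation.Binary.PropositionalEquality using (_≡_)
import Algebra.Definitions.RawMonoid as RM

module _ {c ℓ : Level} (G : AbelianGroup c ℓ) where
  open AbelianGroup G
  open RM rawMonoid using (sum) renaming (_×_ to _·ℕ_)

  Subset : (p : Level) → Set (c ⊔ Level.suc p)
  Subset p = Carrier → Set p

  Respects≈ : ∀ {p} → Subset p → Set (c ⊔ ℓ ⊔ p)
  Respects≈ A = ∀ {x y} → x ≈ y → A x → A y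

  _·ℤ_ : ℤ → Carrier → Carrier
  (+ n) ·ℤ g = n ·ℕ g
  -[1+ n ] ·ℤ g = (suc n ·ℕ g) ⁻¹

  lin : ∀ {d} → (Fin d → Carrier) → (Fin d → ℤ) → Carrier
  lin a x = sum (λ i → x i ·ℤ a i)

  HasSize : ∀ {p} → Subset p → ℕ → Set (c ⊔ ℓ ⊔ p)
  HasSize A m = Σ (Fin m → Carrier) λ f →
      (∀ i → A (f i))
    × (∀ i j → f i ≈ f j → i ≡ j)
    × (∀ g → A g → ∃ λ i → g ≈ f i)

  IsFinite : Set (c ⊔ ℓ)
  IsFinite = ∃ λ n → HasSize (λ _ → ⊤ {ℓ}) n

  record IsSubgroup {p} (H : Subset p) : Set (c ⊔ ℓ ⊔ p) where
    field
      resp  : Respects≈ H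
      has-ε : H ε
      ∙-closed : ∀ {x y} → H x → H y → H (x ∙ y)
      ⁻¹-closed : ∀ {x} → H x → H (x ⁻¹)

  InP : ∀ {d} → (Fin d → Carrier) → (Fin d → ℕ) → ℕ → Subset ℓ
  InP a N t g = ∃ λ (x : Fin d → ℤ) → (∀ i → ∣ x i ∣ ≤ t * N i) × (g ≈ lin a x)
    where d = _

  SumSet : ∀ {p q} → Subset p → Subset q → Subset (c ⊔ ℓ ⊔ p ⊔ q)
  SumSet H A g = ∃ λ h → ∃ λ y → H h × A y × (g ≈ h ∙ y)

  IsProper : ∀ {d} → (Fin d → Carrier) → (Fin d → ℕ) → ℕ → Set ℓ
  IsProper {d} a N t = ∀ (x y : Fin d → ℤ) →
      (∀ i → ∣ x i ∣ ≤ t * N i) → (∀ i → ∣ y i ∣ ≤ t * N i) →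
      lin a x ≈ lin a y → ∀ i → x i ≡ y i

  Is2Proper : ∀ {p d} → Subset p → (Fin d → Carrier) → (Fin d → ℕ) → Set (c ⊔ ℓ ⊔ p)
  Is2Proper H a N = IsProper a N 2 × ∃ λ m₁ → ∃ λ m₂ →
      HasSize H m₁ × HasSize (InP a N 2) m₂ × HasSize (SumSet H (InP a N 2)) (m₁ * m₂)

  InKX : ∀ {p} → ℕ → Subset p → Subset (c ⊔ ℓ ⊔ p)
  InKX k X g = ∃ λ (x : Fin k → Carrier) → (∀ i → X (x i)) × (g ≈ sum x)

  -- { Σ x_i a_i : |x_i| ≤ 2 N_i / k }, i.e. k |x_i| ≤ 2 N_i
  InPScaled : ∀ {d} → (Fin d → Carrier) → (Fin d → ℕ) → ℕ → Subset ℓ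
  InPScaled {d} a N k g = ∃ λ (x : Fin d → ℤ) → (∀ i → k * ∣ x i ∣ ≤ 2 * N i) × (g ≈ lin a x)

{-# OPTIONS --safe #-}
-- Write g = h₁ + Σ yᵢaᵢ with h₁ ∈ H and |yᵢ| ≤ Nᵢ, possible as X ⊆ kX ⊆ H + P by 0 ∈ X.
-- Every multiple jg with j ≤ k lies in kX, hence in H + P.  If jg = h + Σ zᵢaᵢ with z = jy,
-- then (j+1)g = (h₁ + h) + Σ (yᵢ + zᵢ)aᵢ is a representation in H + P₂; since H + P is
-- 2-proper, representations in H + P₂ are unique, so the one of (j+1)g in H + P has
-- coefficients (j+1)y.  For j = k this gives k|yᵢ| ≤ Nᵢ ≤ 2Nᵢ.
module Submission where

open import Defs
open import Level using (Level)
open import Algebra.Bundles using (AbelianGroup)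
open import Data.Nat using (ℕ; suc)
open import Data.Fin using (Fin)

open import Data.Nat using (zero; _≤_; z≤n; s≤s)
import Data.Nat as ℕ
import Data.Nat.Properties as ℕP
open import Data.Integer using (ℤ; +_; -[1+_]; ∣_∣; _⊖_)
import Data.Integer as ℤ
import Data.Integer.Properties as ℤP
open import Data.Fin using (punchOut; combine; remQuot)
open import Data.Fin.Properties
  using (any?; _≟_; punchOut-injective; injective⇒≤; remQuot-combine; combine-injective)
open import Data.Product using (∃; _×_; _,_; proj₁; proj₂)
open import Function using (_∘_)
open import Function.Definitions using (Injective; StrictlySurjective)
open import Relation.Nullary using (yes; no; contradiction)
open import Relation.Binary.PropositionalEquality using (_≡_; _≢_)
import Relation.Binary.PropositionalEquality as ≡
import Algebra.Definitions.RawMonoid as RawMonoid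

injective⇒strictlySurjective : ∀ {n} {f : Fin n → Fin n} →
  Injective _≡_ _≡_ f → StrictlySurjective _≡_ f
injective⇒strictlySurjective {suc n} {f} f-inj y with any? (λ x → f x ≟ y)
... | yes preimage = preimage
... | no no-preimage = contradiction (injective⇒≤ punchOut∘f-injective) ℕP.1+n≰n
  where
  y≢f : ∀ x → y ≢ f x
  y≢f x y≡fx = no-preimage (x , ≡.sym y≡fx)
  punchOut∘f : Fin (suc n) → Fin n
  punchOut∘f x = punchOut (y≢f x)
  punchOut∘f-injective : Injective _≡_ _≡_ punchOut∘f
  punchOut∘f-injective {x} {x'} = f-inj ∘ punchOut-injective (y≢f x) (y≢f x')

strictlySurjective⇒injective : ∀ {n} {f : Fin n → Fin n} →
  StrictlySurjective _≡_ f → Injective _≡_ _≡_ f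
strictlySurjective⇒injective {n} {f} f-surj {a} {b} fa≡fb = begin
  a              ≡⟨ ≡.sym (section∘f a) ⟩
  section (f a)  ≡⟨ ≡.cong section fa≡fb ⟩
  section (f b)  ≡⟨ section∘f b ⟩
  b              ∎
  where
  open ≡.≡-Reasoning
  section : Fin n → Fin n
  section = proj₁ ∘ f-surj
  f∘section : ∀ y → f (section y) ≡ y
  f∘section = proj₂ ∘ f-surj
  section-injective : Injective _≡_ _≡_ section
  section-injective {y} {y'} e =
    ≡.trans (≡.sym (f∘section y)) (≡.trans (≡.cong f e) (f∘section y'))
  section∘f : ∀ x → section (f x) ≡ x
  section∘f x with x' , sx'≡x ← injective⇒strictlySurjective section-injective x = begin
    section (f x)             ≡⟨ ≡.cong (section ∘ f) (≡.sym sx'≡x) ⟩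
    section (f (section x'))  ≡⟨ ≡.cong section (f∘section x') ⟩
    section x'                ≡⟨ sx'≡x ⟩
    x                         ∎

∣+∣-bounded : ∀ {s t n} i j → ∣ i ∣ ≤ s ℕ.* n → ∣ j ∣ ≤ t ℕ.* n →
              ∣ i ℤ.+ j ∣ ≤ (s ℕ.+ t) ℕ.* n
∣+∣-bounded {s} {t} {n} i j i-bd j-bd = begin
  ∣ i ℤ.+ j ∣          ≤⟨ ℤP.∣i+j∣≤∣i∣+∣j∣ i j ⟩
  ∣ i ∣ ℕ.+ ∣ j ∣      ≤⟨ ℕP.+-mono-≤ i-bd j-bd ⟩
  s ℕ.* n ℕ.+ t ℕ.* n  ≡⟨ ℕP.*-distribʳ-+ n s t ⟨
  (s ℕ.+ t) ℕ.* n      ∎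
  where open ℕP.≤-Reasoning

module _ {c ℓ} (G : AbelianGroup c ℓ) where
  open AbelianGroup G
  open RawMonoid rawMonoid using (sum) renaming (_×_ to _·ℕ_)
  open import Algebra.Properties.AbelianGroup G using (⁻¹-∙-comm)
  open import Algebra.Properties.Group group using (ε⁻¹≈ε)
  open import Algebra.Properties.Monoid.Mult monoid using (×-homo-+)
  open import Algebra.Properties.CommutativeMonoid.Sum commutativeMonoid
    using (∑-distrib-+; sum-cong-≋; sum-replicate-zero)
  open import Algebra.Properties.CommutativeSemigroup commutativeSemigroup using (interchange)
  open import Relation.Binary.Reasoning.Setoid setoid

  private
    _·_ : ℤ → Carrier → Carrier
    _·_ = _·ℤ_ G

  ∙-∙⁻¹-cancelˡ : ∀ g x y → (g ∙ x) ∙ (g ∙ y) ⁻¹ ≈ x ∙ y ⁻¹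
  ∙-∙⁻¹-cancelˡ g x y = begin
    (g ∙ x) ∙ (g ∙ y) ⁻¹       ≈⟨ ∙-congˡ (sym (⁻¹-∙-comm g y)) ⟩
    (g ∙ x) ∙ (g ⁻¹ ∙ y ⁻¹)    ≈⟨ interchange g x (g ⁻¹) (y ⁻¹) ⟩
    (g ∙ g ⁻¹) ∙ (x ∙ y ⁻¹)    ≈⟨ ∙-congʳ (inverseʳ g) ⟩
    ε ∙ (x ∙ y ⁻¹)             ≈⟨ identityˡ _ ⟩
    x ∙ y ⁻¹                   ∎

  ·ℤ-neg : ∀ n g → (ℤ.- (+ n)) · g ≈ (n ·ℕ g) ⁻¹
  ·ℤ-neg zero    g = sym ε⁻¹≈ε
  ·ℤ-neg (suc n) g = refl

  ⊖-·ℤ : ∀ m n g → (m ⊖ n) · g ≈ m ·ℕ g ∙ (n ·ℕ g) ⁻¹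
  ⊖-·ℤ zero n g = begin
    (zero ⊖ n) · g     ≡⟨ ≡.cong (_· g) (ℤP.⊖-≤ {zero} {n} z≤n) ⟩
    (ℤ.- (+ n)) · g    ≈⟨ ·ℤ-neg n g ⟩
    (n ·ℕ g) ⁻¹        ≈⟨ identityˡ _ ⟨
    ε ∙ (n ·ℕ g) ⁻¹    ∎
  ⊖-·ℤ (suc m) zero g = begin
    suc m ·ℕ g           ≈⟨ identityʳ _ ⟨
    suc m ·ℕ g ∙ ε       ≈⟨ ∙-congˡ ε⁻¹≈ε ⟨
    suc m ·ℕ g ∙ ε ⁻¹    ∎
  ⊖-·ℤ (suc m) (suc n) g = begin
    (suc m ⊖ suc n) · g         ≡⟨ ≡.cong (_· g) (ℤP.[1+m]⊖[1+n]≡m⊖n m n) ⟩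
    (m ⊖ n) · g                 ≈⟨ ⊖-·ℤ m n g ⟩
    m ·ℕ g ∙ (n ·ℕ g) ⁻¹        ≈⟨ ∙-∙⁻¹-cancelˡ g _ _ ⟨
    suc m ·ℕ g ∙ (suc n ·ℕ g) ⁻¹ ∎

  ·ℤ-homo-+ : ∀ m n g → (m ℤ.+ n) · g ≈ m · g ∙ n · g
  ·ℤ-homo-+ (+ m)    (+ n)    g = ×-homo-+ g m n
  ·ℤ-homo-+ (+ m)    -[1+ n ] g = ⊖-·ℤ m (suc n) g
  ·ℤ-homo-+ -[1+ m ] (+ n)    g = trans (⊖-·ℤ n (suc m) g) (comm _ _)
  ·ℤ-homo-+ -[1+ m ] -[1+ n ] g = begin
    (suc (suc (m ℕ.+ n)) ·ℕ g) ⁻¹       ≡⟨ ≡.cong (λ t → (t ·ℕ g) ⁻¹) (ℕP.+-suc (suc m) n) ⟨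
    ((suc m ℕ.+ suc n) ·ℕ g) ⁻¹         ≈⟨ ⁻¹-cong (×-homo-+ g (suc m) (suc n)) ⟩
    (suc m ·ℕ g ∙ suc n ·ℕ g) ⁻¹        ≈⟨ ⁻¹-∙-comm _ _ ⟨
    (suc m ·ℕ g) ⁻¹ ∙ (suc n ·ℕ g) ⁻¹   ∎

  lin-+ : ∀ {d} (a : Fin d → Carrier) x y →
          lin G a (λ i → x i ℤ.+ y i) ≈ lin G a x ∙ lin G a y
  lin-+ {d} a x y = trans (sum-cong-≋ {d} (λ i → ·ℤ-homo-+ (x i) (y i) (a i)))
                          (∑-distrib-+ (λ i → x i · a i) (λ i → y i · a i))

  lin-0 : ∀ {d} (a : Fin d → Carrier) → lin G a (λ _ → + 0) ≈ ε
  lin-0 {d} a = sum-replicate-zero d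

  InKX-multiple : ∀ {p} {X : Subset G p} → X ε → ∀ {x} → X x →
                  ∀ {j n} → j ≤ n → InKX G n X (j ·ℕ x)
  InKX-multiple X0 Xx {zero} {zero} _ = (λ ()) , (λ ()) , refl
  InKX-multiple {X = X} X0 Xx {zero} {suc n} _
    with v , Xv , e ← InKX-multiple {X = X} X0 Xx {zero} {n} z≤n =
    (λ { Fin.zero → ε ; (Fin.suc i) → v i }) ,
    (λ { Fin.zero → X0 ; (Fin.suc i) → Xv i }) ,
    trans e (sym (identityˡ _))
  InKX-multiple {X = X} X0 {x} Xx {suc j} {suc n} (s≤s j≤n)
    with v , Xv , e ← InKX-multiple {X = X} X0 Xx j≤n =
    (λ { Fin.zero → x ; (Fin.suc i) → v i }) ,
    (λ { Fin.zero → Xx ; (Fin.suc i) → Xv i }) ,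
    ∙-congˡ e

  -- Sending (i , j) to the index of fA i ∙ fB j in the enumeration of A + B is onto, so by
  -- |A + B| = |A||B| it is a surjective, hence injective, self-map of Fin (m₁ * m₂).
  sumSet-size⇒unique-summand : ∀ {q r} {A : Subset G q} {B : Subset G r} {m₁ m₂} →
    HasSize G A m₁ → HasSize G B m₂ → HasSize G (SumSet G A B) (m₁ ℕ.* m₂) →
    ∀ {x x' y y'} → A x → A x' → B y → B y' → x ∙ y ≈ x' ∙ y' → y ≈ y'
  sumSet-size⇒unique-summand {m₁ = m₁} {m₂}
    (fA , fA∈A , _ , onto-A) (fB , fB∈B , _ , onto-B) (fS , fS∈S , fS-inj , onto-S)
    Ax Ax' By By' xy≈x'y'
    with i , x≈ ← onto-A _ Ax | j , y≈ ← onto-B _ By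
       | i' , x'≈ ← onto-A _ Ax' | j' , y'≈ ← onto-B _ By' = begin
      _      ≈⟨ y≈ ⟩
      fB j   ≡⟨ ≡.cong fB (proj₂ (combine-injective i j i' j' (index-injective index≡))) ⟩
      fB j'  ≈⟨ y'≈ ⟨
      _      ∎
    where
    index : Fin m₁ → Fin m₂ → Fin (m₁ ℕ.* m₂)
    index i j = proj₁ (onto-S (fA i ∙ fB j) (fA i , fB j , fA∈A i , fB∈B j , refl))
    index-spec : ∀ i j → fA i ∙ fB j ≈ fS (index i j)
    index-spec i j = proj₂ (onto-S (fA i ∙ fB j) (fA i , fB j , fA∈A i , fB∈B j , refl))
    index∘remQuot : Fin (m₁ ℕ.* m₂) → Fin (m₁ ℕ.* m₂)
    index∘remQuot t = index (proj₁ (remQuot {m₁} m₂ t)) (proj₂ (remQuot {m₁} m₂ t))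
    index∘remQuot-combine : ∀ i j → index∘remQuot (combine i j) ≡ index i j
    index∘remQuot-combine i j = ≡.cong (λ (i , j) → index i j) (remQuot-combine {m₁} {m₂} i j)
    index∘remQuot-surjective : StrictlySurjective _≡_ index∘remQuot
    index∘remQuot-surjective s =
      let x , y , Ax , By , s≈ = fS∈S s
          i , x≈ = onto-A x Ax
          j , y≈ = onto-B y By
      in combine i j ,
      ≡.trans (index∘remQuot-combine i j)
            (≡.sym (fS-inj s (index i j) (trans s≈ (trans (∙-cong x≈ y≈) (index-spec i j)))))
    index-injective : ∀ {i j i' j'} → index i j ≡ index i' j' → combine i j ≡ combine i' j'
    index-injective {i} {j} {i'} {j'} e = strictlySurjective⇒injective index∘remQuot-surjective
      (≡.trans (index∘remQuot-combine i j) (≡.trans e (≡.sym (index∘remQuot-combine i' j'))))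
    index≡ : index i j ≡ index i' j'
    index≡ = fS-inj _ _ (begin
      fS (index i j)   ≈⟨ index-spec i j ⟨
      fA i ∙ fB j      ≈⟨ ∙-cong x≈ y≈ ⟨
      _                ≈⟨ xy≈x'y' ⟩
      _                ≈⟨ ∙-cong x'≈ y'≈ ⟩
      fA i' ∙ fB j'    ≈⟨ index-spec i' j' ⟩
      fS (index i' j') ∎)

  module CosetProgression {q d} (H : Subset G q) (a : Fin d → Carrier) (N : Fin d → ℕ) where

    Bounded : ℕ → (Fin d → ℤ) → Set
    Bounded t z = ∀ i → ∣ z i ∣ ≤ t ℕ.* N i

    _∈H+lin_ : Carrier → (Fin d → ℤ) → Set (c Level.⊔ ℓ Level.⊔ q)
    g ∈H+lin z = ∃ λ h → H h × g ≈ h ∙ lin G a z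

    _⊛_ : ℕ → (Fin d → ℤ) → Fin d → ℤ
    (j ⊛ y) i = + j ℤ.* y i

    _⊕_ : (Fin d → ℤ) → (Fin d → ℤ) → Fin d → ℤ
    (y ⊕ z) i = y i ℤ.+ z i

    Bounded-mono : ∀ {s t} z → s ≤ t → Bounded s z → Bounded t z
    Bounded-mono z s≤t z-bd i = ℕP.≤-trans (z-bd i) (ℕP.*-monoˡ-≤ (N i) s≤t)

    Bounded-⊕ : ∀ {s t y z} → Bounded s y → Bounded t z → Bounded (s ℕ.+ t) (y ⊕ z)
    Bounded-⊕ {s} {t} {y} {z} y-bd z-bd i = ∣+∣-bounded {s} {t} (y i) (z i) (y-bd i) (z-bd i)

    SumSet-InP⇒∈H+lin : ∀ {t g} → SumSet G H (InP G a N t) g →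
      ∃ λ z → Bounded t z × g ∈H+lin z
    SumSet-InP⇒∈H+lin (h , p , Hh , (z , z-bd , p≈) , g≈) =
      z , z-bd , h , Hh , trans g≈ (∙-congˡ p≈)

    ∈H+lin⇒SumSet-InPScaled : ∀ {t g y} → (∀ i → t ℕ.* ∣ y i ∣ ≤ 2 ℕ.* N i) → g ∈H+lin y →
      SumSet G H (InPScaled G a N t) g
    ∈H+lin⇒SumSet-InPScaled {y = y} y-bd (h , Hh , g≈) =
      h , lin G a y , Hh , (y , y-bd , refl) , g≈

    ∈H+lin-resp : ∀ {g g' z} → g ≈ g' → g ∈H+lin z → g' ∈H+lin z
    ∈H+lin-resp g≈g' (h , Hh , g≈) = h , Hh , trans (sym g≈g') g≈

    ∈H+lin-cong : ∀ {g y z} → (∀ i → y i ≡ z i) → g ∈H+lin y → g ∈H+lin z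
    ∈H+lin-cong y≗z (h , Hh , g≈) =
      h , Hh , trans g≈ (∙-congˡ (sum-cong-≋ (λ i → reflexive (≡.cong (_· a i) (y≗z i)))))

    ∈H+lin-zero : IsSubgroup G H → ε ∈H+lin (λ _ → + 0)
    ∈H+lin-zero H-subgroup = ε , has-ε , sym (trans (identityˡ _) (lin-0 a))
      where open IsSubgroup H-subgroup

    ∈H+lin-∙ : IsSubgroup G H → ∀ {g g' y z} →
      g ∈H+lin y → g' ∈H+lin z → (g ∙ g') ∈H+lin (y ⊕ z)
    ∈H+lin-∙ H-subgroup {g} {g'} {y} {z} (h , Hh , g≈) (h' , Hh' , g'≈) =
      h ∙ h' , ∙-closed Hh Hh' , (begin
        g ∙ g'                               ≈⟨ ∙-cong g≈ g'≈ ⟩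
        (h ∙ lin G a y) ∙ (h' ∙ lin G a z)   ≈⟨ interchange _ _ _ _ ⟩
        (h ∙ h') ∙ (lin G a y ∙ lin G a z)   ≈⟨ ∙-congˡ (lin-+ a y z) ⟨
        (h ∙ h') ∙ lin G a (y ⊕ z)           ∎)
      where open IsSubgroup H-subgroup

    2proper⇒unique-coefficients : Is2Proper G H a N → ∀ {g} y z →
      Bounded 2 y → Bounded 2 z → g ∈H+lin y → g ∈H+lin z → ∀ i → y i ≡ z i
    2proper⇒unique-coefficients (proper , _ , _ , H-size , P₂-size , H+P₂-size)
      y z y-bd z-bd (h , Hh , g≈) (h' , Hh' , g≈') =
      proper y z y-bd z-bd
        (sumSet-size⇒unique-summand H-size P₂-size H+P₂-size Hh Hh'
          (y , y-bd , refl) (z , z-bd , refl) (trans (sym g≈) g≈'))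

    multiples-coefficients : IsSubgroup G H → Is2Proper G H a N → ∀ {g y} →
      Bounded 1 y → g ∈H+lin y → ∀ {n} →
      (∀ j → j ≤ n → ∃ λ z → Bounded 1 z × (j ·ℕ g) ∈H+lin z) →
      ∀ j → j ≤ n → Bounded 1 (j ⊛ y) × (j ·ℕ g) ∈H+lin (j ⊛ y)
    multiples-coefficients H-subgroup 2proper {g} {y} y-bd g∈ multiple∈ zero _ =
      (λ _ → z≤n) , ∈H+lin-zero H-subgroup
    multiples-coefficients H-subgroup 2proper {g} {y} y-bd g∈ multiple∈ (suc j) 1+j≤n
      with w , w-bd , w∈ ← multiple∈ (suc j) 1+j≤n =
      (λ i → ℕP.≤-trans (ℕP.≤-reflexive (≡.cong ∣_∣ (≡.sym (w≡ i)))) (w-bd i)) ,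
      ∈H+lin-cong w≡ w∈
      where
      IH : Bounded 1 (j ⊛ y) × (j ·ℕ g) ∈H+lin (j ⊛ y)
      IH = multiples-coefficients H-subgroup 2proper y-bd g∈ multiple∈ j
             (ℕP.≤-trans (ℕP.n≤1+n j) 1+j≤n)
      sum-bd : Bounded 2 (y ⊕ (j ⊛ y))
      sum-bd = Bounded-⊕ {1} {1} {y} {j ⊛ y} y-bd (proj₁ IH)
      sum∈ : (suc j ·ℕ g) ∈H+lin (y ⊕ (j ⊛ y))
      sum∈ = ∈H+lin-∙ H-subgroup {y = y} {z = j ⊛ y} g∈ (proj₂ IH)
      w≡ : ∀ i → w i ≡ (suc j ⊛ y) i
      w≡ i = ≡.trans
        (2proper⇒unique-coefficients 2proper w (y ⊕ (j ⊛ y))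
          (Bounded-mono {1} {2} w (s≤s z≤n) w-bd) sum-bd w∈ sum∈ i)
        (≡.sym (ℤP.suc-* (+ j) (y i)))

    multiples∈H+P⇒∈H+scaledP : IsSubgroup G H → Is2Proper G H a N → ∀ {g k} →
      (∀ j → j ≤ suc k → ∃ λ z → Bounded 1 z × (j ·ℕ g) ∈H+lin z) →
      SumSet G H (InPScaled G a N (suc k)) g
    multiples∈H+P⇒∈H+scaledP H-subgroup 2proper {g} {k} multiple∈
      with y , y-bd , 1g∈ ← multiple∈ 1 (s≤s z≤n) =
      ∈H+lin⇒SumSet-InPScaled {suc k} {g} {y} scaled-bound g∈
      where
      g∈ : g ∈H+lin y
      g∈ = ∈H+lin-resp {z = y} (identityʳ g) 1g∈
      [1+k]y-bd : Bounded 1 (suc k ⊛ y)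
      [1+k]y-bd = proj₁ (multiples-coefficients H-subgroup 2proper {g} {y} y-bd g∈ multiple∈
                           (suc k) ℕP.≤-refl)
      scaled-bound : ∀ i → suc k ℕ.* ∣ y i ∣ ≤ 2 ℕ.* N i
      scaled-bound i = ℕP.≤-trans (ℕP.≤-reflexive (≡.sym (ℤP.abs-* (+ suc k) (y i))))
        (Bounded-mono {1} {2} (suc k ⊛ y) (s≤s z≤n) [1+k]y-bd i)

lemma2p4 : ∀ {c ℓ p q : Level} (G : AbelianGroup c ℓ) → IsFinite G →
    (X : Subset G p) → Respects≈ G X → X (AbelianGroup.ε G) →
    (k : ℕ) → (H : Subset G q) → IsSubgroup G H →
    (d : ℕ) (a : Fin d → AbelianGroup.Carrier G) (N : Fin d → ℕ) →
    Is2Proper G H a N →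
    (∀ g → InKX G (suc k) X g → SumSet G H (InP G a N 1) g) →
    ∀ g → X g → SumSet G H (InPScaled G a N (suc k)) g
lemma2p4 G _ X _ X0 k H H-subgroup d a N 2proper kX⊆H+P g Xg =
  multiples∈H+P⇒∈H+scaledP H-subgroup 2proper multiple∈H+P
  where
  open RawMonoid (AbelianGroup.rawMonoid G) using () renaming (_×_ to _·ℕ_)
  open CosetProgression G H a N

  multiple∈H+P : ∀ j → j ≤ suc k → ∃ λ z → Bounded 1 z × (j ·ℕ g) ∈H+lin z
  multiple∈H+P j j≤1+k =
    SumSet-InP⇒∈H+lin {1} (kX⊆H+P _ (InKX-multiple G {X = X} X0 Xg j≤1+k))
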